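{- Let $H=(X,\mathcal{B})$ be a hypergraph and $I\subseteq X$ an independent set. Let $x,y\in I$ with $d(x)=2$ and $d(y)=3$, and let $z$ be a vertex of degree $2$ adjacent to both $x$ and $y$. Suppose there exists an $I$-toe $w$ of degree $2$ which is adjacent to $x$ but not adjacent to $z$. Then $I'=(I\setminus\{x,y\})\cup\{w,z\}$ is an independent set.
   Context: $d(v)$ denotes the degree of $v$, the number of blocks containing $v$. Two vertices are adjacent if they lie in a common block; an independent set is a set of pairwise non-adjacent vertices. $\mathcal{B}_I$ denotes the set of blocks meeting $I$. An $I$-toe is a vertex of degree at least $2$ that lies in exactly one block of $\mathcal{B}_I$. -}

module Defs where

open import Data.Nat using (ℕ; _≤_)
open import Data.Fin using (Fin)
open import Data.Fin.Subset public using (Subset; _∈_; _∉_; ⁅_⁆; _∪_; _-_; ∣_∣)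
open import Data.Vec using (tabulate; lookup)
open import Data.Product using (Σ; ∃; _×_)
open import Relation.Binary.PropositionalEquality using (_≡_; _≢_)
open import Relation.Nullary using (¬_)

record Hypergraph : Set where
  field
    n     : ℕ
    m     : ℕ
    block : Fin m → Subset n

module _ (H : Hypergraph) where
  open Hypergraph H

  Vertex : Set
  Vertex = Fin n

  Block : Set
  Block = Fin m

  blocksAt : Vertex → Subset m
  blocksAt v = tabulate (λ b → lookup (block b) v)

  degree : Vertex → ℕ
  degree v = ∣ blocksAt v ∣

  Adjacent : Vertex → Vertex → Set
  Adjacent u v = u ≢ v × ∃ λ (b : Block) → u ∈ block b × v ∈ block b

  Independent : Subset n → Set
  Independent S = ∀ u v → u ∈ S → v ∈ S → ¬ Adjacent u v

  Meets : Subset n → Block → Set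
  Meets I b = ∃ λ u → u ∈ I × u ∈ block b

  IToe : Subset n → Vertex → Set
  IToe I w = 2 ≤ degree w ×
    (∃ λ (b : Block) → (w ∈ block b × Meets I b) ×
       (∀ b′ → w ∈ block b′ → Meets I b′ → b′ ≡ b))

-- An I-toe has a unique block meeting I, so
-- by independence all its neighbours in I coincide; as w is adjacent to x, it
-- is adjacent to no other vertex of I. The blocks joining z to x, to y and to a
-- third vertex of I would be pairwise distinct by independence, which is
-- impossible for d(z) = 2; so z has no neighbour in I ∖ {x, y}. Finally z and
-- w are not adjacent by hypothesis.
module Submission where

open import Defs
open import Relation.Binary.PropositionalEquality using (_≡_; _≢_; refl; sym; trans)
open import Relation.Nullary using (¬_)
open import Data.Nat using (_≤_; s≤s; z≤n)
open import Data.Nat.Properties using (≤-trans; ≤-reflexive; <⇒≱)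
open import Data.Fin using (Fin)
open import Data.Fin.Subset using (_⊆_; _─_; outside)
open import Data.Fin.Subset.Properties
  using (x∈p∪q⁻; x∈⁅y⁆⇒x≡y; x∉⁅y⁆⇒x≢y; x∈p⇒∣p-x∣<∣p∣; x∈p∧x≢y⇒x∈p-y; p─q⊆p)
open import Data.Vec using (_∷_; lookup; here; there)
open import Data.Vec.Properties using (lookup⇒[]=; []=⇒lookup; lookup∘tabulate)
open import Data.Product using (_,_; proj₁)
open import Data.Sum using (inj₁; inj₂)
open import Function using (_∘_)

x∈p─q⇒x∉q : ∀ {n} {x : Fin n} (p q : Subset n) → x ∈ p ─ q → x ∉ q
x∈p─q⇒x∉q (_ ∷ p) (outside ∷ q) here ()
x∈p─q⇒x∉q (_ ∷ p) (_ ∷ q) (there x∈) (there x∈q) = x∈p─q⇒x∉q p q x∈ x∈q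

x∈p-y⇒x≢y : ∀ {n} {x y : Fin n} (p : Subset n) → x ∈ p - y → x ≢ y
x∈p-y⇒x≢y {y = y} p = x∉⁅y⁆⇒x≢y ∘ x∈p─q⇒x∉q p ⁅ y ⁆

x∈p-y⇒x∈p : ∀ {n} {x y : Fin n} (p : Subset n) → x ∈ p - y → x ∈ p
x∈p-y⇒x∈p {y = y} p = p─q⊆p p ⁅ y ⁆

3≤∣p∣ : ∀ {n} {p : Subset n} {a b c : Fin n} → a ∈ p → b ∈ p → c ∈ p →
        a ≢ b → a ≢ c → b ≢ c → 3 ≤ ∣ p ∣
3≤∣p∣ {p = p} {a} {b} {c} a∈p b∈p c∈p a≢b a≢c b≢c =
  ≤-trans (s≤s (≤-trans (s≤s (≤-trans (s≤s z≤n) (x∈p⇒∣p-x∣<∣p∣ c∈p-a-b)))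
                        (x∈p⇒∣p-x∣<∣p∣ b∈p-a)))
          (x∈p⇒∣p-x∣<∣p∣ a∈p)
  where
  b∈p-a : b ∈ p - a
  b∈p-a = x∈p∧x≢y⇒x∈p-y b∈p (a≢b ∘ sym)
  c∈p-a-b : c ∈ p - a - b
  c∈p-a-b = x∈p∧x≢y⇒x∈p-y (x∈p∧x≢y⇒x∈p-y c∈p (a≢c ∘ sym)) (b≢c ∘ sym)

module _ (H : Hypergraph) where
  open Hypergraph H

  adjacent-sym : ∀ {u v} → Adjacent H u v → Adjacent H v u
  adjacent-sym (u≢v , b , u∈b , v∈b) = u≢v ∘ sym , b , v∈b , u∈b

  ∈block⇒∈blocksAt : ∀ {v : Vertex H} {b : Block H} → v ∈ block b → b ∈ blocksAt H v
  ∈block⇒∈blocksAt {v} {b} v∈b = lookup⇒[]= b (blocksAt H v)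
    (trans (lookup∘tabulate (λ b → lookup (block b) v) b) ([]=⇒lookup v∈b))

  independent-⊆ : ∀ {S T} → S ⊆ T → Independent H T → Independent H S
  independent-⊆ S⊆T ind u v u∈S v∈S = ind u v (S⊆T u∈S) (S⊆T v∈S)

  independent-∪⁅⁆ : ∀ {S} {a : Vertex H} → Independent H S →
    (∀ u → u ∈ S → ¬ Adjacent H a u) → Independent H (S ∪ ⁅ a ⁆)
  independent-∪⁅⁆ {S} {a} ind a≁S u v u∈ v∈ u~v
    with x∈p∪q⁻ S ⁅ a ⁆ u∈ | x∈p∪q⁻ S ⁅ a ⁆ v∈
  ... | inj₁ u∈S | inj₁ v∈S = ind u v u∈S v∈S u~v
  ... | inj₁ u∈S | inj₂ v∈a rewrite x∈⁅y⁆⇒x≡y a v∈a = a≁S u u∈S (adjacent-sym u~v)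
  ... | inj₂ u∈a | inj₁ v∈S rewrite x∈⁅y⁆⇒x≡y a u∈a = a≁S v v∈S u~v
  ... | inj₂ u∈a | inj₂ v∈a rewrite x∈⁅y⁆⇒x≡y a u∈a | x∈⁅y⁆⇒x≡y a v∈a = proj₁ u~v refl

  independent⇒blocks-distinct : ∀ {I u v} {b b′ : Block H} → Independent H I →
    u ∈ I → v ∈ I → u ≢ v → u ∈ block b → v ∈ block b′ → b ≢ b′
  independent⇒blocks-distinct {u = u} {v} ind u∈I v∈I u≢v u∈b v∈b′ refl =
    ind u v u∈I v∈I (u≢v , _ , u∈b , v∈b′)

  toe-¬adjacent : ∀ {I w x u} → Independent H I → IToe H I w →
    x ∈ I → u ∈ I → u ≢ x → Adjacent H w x → ¬ Adjacent H w u
  toe-¬adjacent ind (_ , b , _ , unique) x∈I u∈I u≢x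
                (_ , bx , w∈bx , x∈bx) (_ , bu , w∈bu , u∈bu)
    with unique bx w∈bx (_ , x∈I , x∈bx) | unique bu w∈bu (_ , u∈I , u∈bu)
  ... | refl | refl = independent⇒blocks-distinct ind x∈I u∈I (u≢x ∘ sym) x∈bx u∈bu refl

  degree≤2⇒¬adjacent : ∀ {I z x y u} → Independent H I → degree H z ≤ 2 →
    x ∈ I → y ∈ I → u ∈ I → x ≢ y → u ≢ x → u ≢ y →
    Adjacent H z x → Adjacent H z y → ¬ Adjacent H z u
  degree≤2⇒¬adjacent ind dz≤2 x∈I y∈I u∈I x≢y u≢x u≢y
                     (_ , bx , z∈bx , x∈bx) (_ , by , z∈by , y∈by) (_ , bu , z∈bu , u∈bu)
    = <⇒≱ (3≤∣p∣ (∈block⇒∈blocksAt z∈bx) (∈block⇒∈blocksAt z∈by) (∈block⇒∈blocksAt z∈bu)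
               (independent⇒blocks-distinct ind x∈I y∈I x≢y x∈bx y∈by)
               (independent⇒blocks-distinct ind x∈I u∈I (u≢x ∘ sym) x∈bx u∈bu)
               (independent⇒blocks-distinct ind y∈I u∈I (u≢y ∘ sym) y∈by u∈bu))
          dz≤2

lemma3p19 : (H : Hypergraph) (I : Subset (Hypergraph.n H))
    (x y z w : Vertex H) →
    Independent H I → x ∈ I → y ∈ I →
    degree H x ≡ 2 → degree H y ≡ 3 →
    degree H z ≡ 2 → Adjacent H z x → Adjacent H z y →
    IToe H I w → degree H w ≡ 2 → Adjacent H w x → ¬ Adjacent H w z →
    Independent H ((((I - x) - y) ∪ ⁅ w ⁆) ∪ ⁅ z ⁆)
lemma3p19 H I x y z w ind x∈I y∈I dx dy dz z~x z~y toe _ w~x w≁z =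
  independent-∪⁅⁆ H (independent-∪⁅⁆ H independent-core w≁core) z≁core∪w
  where
  core : Subset (Hypergraph.n H)
  core = (I - x) - y

  ∈core⇒∈I : ∀ {u} → u ∈ core → u ∈ I
  ∈core⇒∈I = x∈p-y⇒x∈p I ∘ x∈p-y⇒x∈p (I - x)

  ∈core⇒≢x : ∀ {u} → u ∈ core → u ≢ x
  ∈core⇒≢x = x∈p-y⇒x≢y I ∘ x∈p-y⇒x∈p (I - x)

  independent-core : Independent H core
  independent-core = independent-⊆ H ∈core⇒∈I ind

  w≁core : ∀ u → u ∈ core → ¬ Adjacent H w u
  w≁core u u∈ = toe-¬adjacent H ind toe x∈I (∈core⇒∈I u∈) (∈core⇒≢x u∈) w~x

  -- d(x) ≠ d(y) is the only use of d(y) = 3.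
  x≢y : x ≢ y
  x≢y refl with trans (sym dx) dy
  ... | ()

  z≁core∪w : ∀ u → u ∈ core ∪ ⁅ w ⁆ → ¬ Adjacent H z u
  z≁core∪w u u∈ with x∈p∪q⁻ core ⁅ w ⁆ u∈
  ... | inj₁ u∈core = degree≤2⇒¬adjacent H ind (≤-reflexive dz) x∈I y∈I (∈core⇒∈I u∈core)
                        x≢y (∈core⇒≢x u∈core) (x∈p-y⇒x≢y (I - x) u∈core) z~x z~y
  ... | inj₂ u∈w rewrite x∈⁅y⁆⇒x≡y w u∈w = w≁z ∘ adjacent-sym H
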